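{- Let $D \in \mathbb Z[x_1,\ldots,x_n]$ be a polynomial such that the set of integer solutions of the equation $D(x_1,\ldots,x_n)=0$ is non-empty and finite, and let $d$ denote the maximal height of an integer solution of this equation. Then the number of integer solutions $(x_1,\ldots,x_n,u_1,u_2,u_3,u_4,v_1,v_2,v_3,v_4)$ of the equation \[ D^2(x_1,\ldots,x_n)+\left(n^2+x_1^2+\ldots+x_n^2-u_1^2-u_2^2-u_3^2-u_4^2-v_1^2-v_2^2-v_3^2-v_4^2\right)^2=0 \] is finite and greater than $d$.
   Context: The height of a rational number $\frac{p}{q}$ written in lowest terms is $\max(|p|,|q|)$ (so the height of an integer $a$ is $|a|$). The height of a rational tuple $(x_1,\ldots,x_n)$ is the maximum of $n$ and the heights of $x_1,\ldots,x_n$. -}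

module Defs where

open import Data.Nat using (ℕ; _⊔_; _<_)
open import Data.Integer using (ℤ; _+_; _*_; _-_; +_; ∣_∣)
open import Data.Fin using (Fin)
open import Data.Vec using (Vec; lookup; foldr; map; [])
open import Data.Product using (_×_; Σ; ∃)
open import Data.List using (List; length)
open import Data.List.Membership.Propositional using (_∈_)
open import Data.List.Relation.Unary.Unique.Propositional using (Unique)
open import Relation.Binary.PropositionalEquality using (_≡_)
open import Function.Bundles using (_⇔_)

-- Polynomials in ℤ[x₁,…,xₙ], as formal expressions (every polynomial
-- is represented by some expression; only evaluation matters here).
data Poly (n : ℕ) : Set where
  var : Fin n → Poly n
  con : ℤ → Poly n
  _⊕_ : Poly n → Poly n → Poly n
  _⊗_ : Poly n → Poly n → Poly n

eval : ∀ {n} → Poly n → Vec ℤ n → ℤ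
eval (var i) x = lookup x i
eval (con c) x = c
eval (p ⊕ q) x = eval p x + eval q x
eval (p ⊗ q) x = eval p x * eval q x

-- Height of an integer a is |a|; height of a tuple (x₁,…,xₙ) is
-- max(n, |x₁|, …, |xₙ|).
height : ∀ {n} → Vec ℤ n → ℕ
height {n} x = foldr (λ _ → ℕ) (λ a m → ∣ a ∣ ⊔ m) n x

sumSq : ∀ {k} → Vec ℤ k → ℤ
sumSq x = foldr (λ _ → ℤ) (λ a s → a * a + s) (+ 0) x

FiniteSet : {A : Set} → (A → Set) → Set
FiniteSet {A} P = Σ (List A) λ L → ∀ a → P a → a ∈ L

IsMaxSolHeight : ∀ {n} → Poly n → ℕ → Set
IsMaxSolHeight {n} D d =
  (Σ (Vec ℤ n) λ x → (eval D x ≡ + 0) × (height x ≡ d)) ×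
  (∀ x → eval D x ≡ + 0 → height x Data.Nat.≤ d)

ExtSol : ∀ {n} → Poly n → Vec ℤ n × Vec ℤ 4 × Vec ℤ 4 → Set
ExtSol {n} D (x Data.Product., u Data.Product., v) =
  let E = + (n Data.Nat.* n) + sumSq x - sumSq u - sumSq v
  in eval D x * eval D x + E * E ≡ + 0

FiniteWithMoreThan : {A : Set} → (A → Set) → ℕ → Set
FiniteWithMoreThan {A} P d =
  Σ (List A) λ L → Unique L × (∀ a → (a ∈ L ⇔ P a)) × (d < length L)

-- Every solution (x, u, v) of the extended equation has D(x) = 0 and |u|² + |v|² = n² + |x|², so
-- its entries are bounded in terms of x and the solutions lie in a finite box over the finitely
-- many roots of D.  Conversely, if x₀ is a root of height d then d² ≤ n² + |x₀|², and for every
-- k ≤ d Lagrange's theorem writes n² + |x₀|² − k² as |u|² with u ∈ ℤ⁴, giving the d + 1 distinct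
-- solutions (x₀, u, (k, 0, 0, 0)).
--
-- Lagrange's theorem is proved by Euler's descent.  Euler's identity makes sums of four squares
-- closed under products, so it suffices to treat primes.  For p = 2h + 1, pigeonhole on the p + 1
-- residues x² and −1 − y² (x, y ≤ h) gives x² + y² + 1 = k p with 0 < k < p.  Given a
-- representation a of k p, reduce a modulo k to b ∈ (−k/2, k/2]⁴; then |b|² = r k with 0 < r < k,
-- and the Euler product of a and b is k times a representation of r p.

module Submission where

open import Defs
open import Data.Nat as ℕ using (ℕ; zero; suc; z≤n; s≤s; NonZero; _≤_; _<_; _∸_; _⊔_)
import Data.Nat.Properties as ℕ
open import Data.Nat.Divisibility using (_∣_; divides; ∣⇒≤; *-cancelˡ-∣)
open import Data.Nat.DivMod using (_%_; _/_; m≡m%n+[m/n]*n; m%n<n)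
open import Data.Nat.Primality using (Prime; composite; euclidsLemma; ¬prime[0]; prime⇒nonTrivial)
open import Data.Nat.Primality.Factorisation using (PrimeFactorisation; factorise)
open import Data.Nat.ListAction using (product)
open import Data.Nat.Induction using (<-rec)
open import Data.Integer as ℤ using (ℤ; +_; -[1+_]; -_; ∣_∣; _+_; _*_; _-_)
import Data.Integer.Properties as ℤ
open import Data.Integer.DivMod using (_/ℕ_; _%ℕ_; a≡a%ℕn+[a/ℕn]*n; n%ℕd<d)
import Data.Integer.Divisibility.Signed as ℤ
open import Data.Integer.Tactic.RingSolver using (solve-∀)
import Data.Nat.Tactic.RingSolver as ℕ
open import Data.Fin using (toℕ; fromℕ<)
import Data.Fin.Properties as Fin
open import Data.Vec using (Vec; []; _∷_; map; zipWith; replicate)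
open import Data.Vec.Relation.Unary.All as All using (All; []; _∷_)
import Data.List.Relation.Unary.All as ListAll
open import Data.List as List using (List; length; upTo; _++_; concatMap; cartesianProduct; cartesianProductWith; filter; deduplicate)
import Data.List.Properties as List
open import Data.List.Membership.Propositional using (_∈_; _∉_)
open import Data.List.Membership.Propositional.Properties
  using (∈-++⁺ˡ; ∈-++⁺ʳ; ∈-++⁻; ∈-map⁺; ∈-map⁻; ∈-upTo⁺; ∈-upTo⁻; ∈-concatMap⁺; ∈-cartesianProductWith⁺;
         ∈-cartesianProduct⁺; ∈-filter⁺; ∈-filter⁻; ∈-deduplicate⁺)
open import Data.List.Membership.DecPropositional using (_∈?_)
open import Data.List.Relation.Unary.Any as Any using (here)
open import Data.List.Relation.Unary.Unique.Propositional using (Unique)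
import Data.List.Relation.Unary.Unique.Propositional.Properties as Unique
open import Data.List.Relation.Unary.Unique.DecPropositional.Properties using (deduplicate-!)
open import Data.Product using (Σ; Σ-syntax; ∃-syntax; _×_; _,_; proj₁; proj₂)
import Data.Product.Properties as Product
import Data.Vec.Properties as Vec
open import Data.Sum using (_⊎_; inj₁; inj₂; [_,_]′)
open import Function using (id)
open import Data.Empty using (⊥-elim)
open import Relation.Nullary using (¬_; yes; no; ¬?; _×-dec_)
open import Relation.Unary using (Decidable)
open import Relation.Binary.Definitions using (DecidableEquality)
open import Function.Bundles using (_⇔_; mk⇔; Equivalence)
open import Relation.Binary.PropositionalEquality

-- Euler's four-square identity

infixl 6 _+ᵥ_
infixr 7 _*ᵥ_

_+ᵥ_ : ∀ {n} → Vec ℤ n → Vec ℤ n → Vec ℤ n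
_+ᵥ_ = zipWith _+_

_*ᵥ_ : ∀ {n} → ℤ → Vec ℤ n → Vec ℤ n
k *ᵥ v = map (k *_) v

FourSquares : ℕ → Set
FourSquares m = Σ[ w ∈ Vec ℤ 4 ] sumSq w ≡ + m

_⊛_ : Vec ℤ 4 → Vec ℤ 4 → Vec ℤ 4
(a₁ ∷ a₂ ∷ a₃ ∷ a₄ ∷ []) ⊛ (b₁ ∷ b₂ ∷ b₃ ∷ b₄ ∷ []) =
  a₁ * b₁ + a₂ * b₂ + a₃ * b₃ + a₄ * b₄ ∷
  a₁ * b₂ - a₂ * b₁ + a₃ * b₄ - a₄ * b₃ ∷
  a₁ * b₃ - a₃ * b₁ + a₄ * b₂ - a₂ * b₄ ∷
  a₁ * b₄ - a₄ * b₁ + a₂ * b₃ - a₃ * b₂ ∷ []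

sumSq-⊛ : ∀ a b → sumSq (a ⊛ b) ≡ sumSq a * sumSq b
sumSq-⊛ (a₁ ∷ a₂ ∷ a₃ ∷ a₄ ∷ []) (b₁ ∷ b₂ ∷ b₃ ∷ b₄ ∷ []) = euler a₁ a₂ a₃ a₄ b₁ b₂ b₃ b₄
  where
  -- ‖_,_,_,_‖ is sumSq of four entries, let-bound so that the ring solver sees a polynomial.
  euler : ∀ a₁ a₂ a₃ a₄ b₁ b₂ b₃ b₄ →
    let ‖_,_,_,_‖ : ℤ → ℤ → ℤ → ℤ → ℤ
        ‖ w , x , y , z ‖ = w * w + (x * x + (y * y + (z * z + + 0)))
    in ‖ a₁ * b₁ + a₂ * b₂ + a₃ * b₃ + a₄ * b₄
       , a₁ * b₂ - a₂ * b₁ + a₃ * b₄ - a₄ * b₃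
       , a₁ * b₃ - a₃ * b₁ + a₄ * b₂ - a₂ * b₄
       , a₁ * b₄ - a₄ * b₁ + a₂ * b₃ - a₃ * b₂ ‖
       ≡ ‖ a₁ , a₂ , a₃ , a₄ ‖ * ‖ b₁ , b₂ , b₃ , b₄ ‖
  euler = solve-∀

fourSquares-* : ∀ {m n} → FourSquares m → FourSquares n → FourSquares (m ℕ.* n)
fourSquares-* {m} {n} (a , sumSq-a) (b , sumSq-b) = a ⊛ b , (begin
  sumSq (a ⊛ b)      ≡⟨ sumSq-⊛ a b ⟩
  sumSq a * sumSq b  ≡⟨ cong₂ _*_ sumSq-a sumSq-b ⟩
  + m * + n          ≡⟨ ℤ.pos-* m n ⟨
  + (m ℕ.* n)        ∎)
  where open ≡-Reasoning

-- Euler's identity for a = b + k t: the product a ⊛ b is |b|² e₁ + k (t ⊛ b).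
sumSq-⊛-shift : ∀ k (b t : Vec ℤ 4) →
  sumSq (b +ᵥ k *ᵥ t) * sumSq b ≡ sumSq ((sumSq b ∷ + 0 ∷ + 0 ∷ + 0 ∷ []) +ᵥ k *ᵥ (t ⊛ b))
sumSq-⊛-shift k (b₁ ∷ b₂ ∷ b₃ ∷ b₄ ∷ []) (t₁ ∷ t₂ ∷ t₃ ∷ t₄ ∷ []) = identity k b₁ b₂ b₃ b₄ t₁ t₂ t₃ t₄
  where
  identity : ∀ k b₁ b₂ b₃ b₄ t₁ t₂ t₃ t₄ →
    let ‖_,_,_,_‖ : ℤ → ℤ → ℤ → ℤ → ℤ
        ‖ w , x , y , z ‖ = w * w + (x * x + (y * y + (z * z + + 0)))
        S = ‖ b₁ , b₂ , b₃ , b₄ ‖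
    in ‖ b₁ + k * t₁ , b₂ + k * t₂ , b₃ + k * t₃ , b₄ + k * t₄ ‖ * S
       ≡ ‖ S + k * (t₁ * b₁ + t₂ * b₂ + t₃ * b₃ + t₄ * b₄)
         , + 0 + k * (t₁ * b₂ - t₂ * b₁ + t₃ * b₄ - t₄ * b₃)
         , + 0 + k * (t₁ * b₃ - t₃ * b₁ + t₄ * b₂ - t₂ * b₄)
         , + 0 + k * (t₁ * b₄ - t₄ * b₁ + t₂ * b₃ - t₃ * b₂) ‖
  identity = solve-∀

sumSq-scaled-head : ∀ k r (c : Vec ℤ 4) →
  sumSq ((k * r ∷ + 0 ∷ + 0 ∷ + 0 ∷ []) +ᵥ k *ᵥ c) ≡ k * (k * sumSq ((r ∷ + 0 ∷ + 0 ∷ + 0 ∷ []) +ᵥ c))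
sumSq-scaled-head k r (c₁ ∷ c₂ ∷ c₃ ∷ c₄ ∷ []) = identity k r c₁ c₂ c₃ c₄
  where
  identity : ∀ k r c₁ c₂ c₃ c₄ →
    let ‖_,_,_,_‖ : ℤ → ℤ → ℤ → ℤ → ℤ
        ‖ w , x , y , z ‖ = w * w + (x * x + (y * y + (z * z + + 0)))
    in ‖ k * r + k * c₁ , + 0 + k * c₂ , + 0 + k * c₃ , + 0 + k * c₄ ‖
       ≡ k * (k * ‖ r + c₁ , + 0 + c₂ , + 0 + c₃ , + 0 + c₄ ‖)
  identity = solve-∀

euler-descent : ∀ {k m r} .{{_ : NonZero k}} (b t : Vec ℤ 4) →
  sumSq b ≡ + (r ℕ.* k) → sumSq (b +ᵥ + k *ᵥ t) ≡ + (k ℕ.* m) → FourSquares (r ℕ.* m)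
euler-descent {k} {m} {r} b t sumSq-b sumSq-a =
  w , ℤ.*-cancelˡ-≡ (+ k) _ _ (ℤ.*-cancelˡ-≡ (+ k) _ _ (begin
    + k * (+ k * sumSq w)                                  ≡⟨ sumSq-scaled-head (+ k) (+ r) (t ⊛ b) ⟨
    sumSq ((+ k * + r ∷ 0s) +ᵥ + k *ᵥ (t ⊛ b))           ≡⟨ cong (λ s → sumSq ((s ∷ 0s) +ᵥ + k *ᵥ (t ⊛ b))) kr≡sumSq-b ⟩
    sumSq ((sumSq b ∷ 0s) +ᵥ + k *ᵥ (t ⊛ b))             ≡⟨ sumSq-⊛-shift (+ k) b t ⟨
    sumSq (b +ᵥ + k *ᵥ t) * sumSq b                       ≡⟨ cong₂ _*_ sumSq-a sumSq-b ⟩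
    + (k ℕ.* m) * + (r ℕ.* k)                             ≡⟨ cong₂ _*_ (ℤ.pos-* k m) (ℤ.pos-* r k) ⟩
    + k * + m * (+ r * + k)                               ≡⟨ rearrange (+ k) (+ m) (+ r) ⟩
    + k * (+ k * (+ r * + m))                             ≡⟨ cong (λ z → + k * (+ k * z)) (ℤ.pos-* r m) ⟨
    + k * (+ k * + (r ℕ.* m))                             ∎))
  where
  open ≡-Reasoning
  0s : Vec ℤ 3
  0s = + 0 ∷ + 0 ∷ + 0 ∷ []
  w : Vec ℤ 4
  w = (+ r ∷ 0s) +ᵥ t ⊛ b
  kr≡sumSq-b : + k * + r ≡ sumSq b
  kr≡sumSq-b = trans (ℤ.*-comm (+ k) (+ r)) (trans (sym (ℤ.pos-* r k)) (sym sumSq-b))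
  rearrange : ∀ k m r → k * m * (r * k) ≡ k * (k * (r * m))
  rearrange = solve-∀

-- Reduction modulo k

k∣sumSq[b+kt]-sumSq[b] : ∀ {n} k (b t : Vec ℤ n) → k ℤ.∣ sumSq (b +ᵥ k *ᵥ t) - sumSq b
k∣sumSq[b+kt]-sumSq[b] k [] [] = ℤ.divides (+ 0) refl
k∣sumSq[b+kt]-sumSq[b] k (b₀ ∷ b) (t₀ ∷ t) =
  subst (k ℤ.∣_) (regroup ((b₀ + k * t₀) * (b₀ + k * t₀)) (b₀ * b₀) _ _)
    (ℤ.∣m∣n⇒∣m+n (ℤ.divides (t₀ * (b₀ + b₀ + k * t₀)) (square-shift b₀ t₀ k)) (k∣sumSq[b+kt]-sumSq[b] k b t))
  where
  square-shift : ∀ b₀ t₀ k → (b₀ + k * t₀) * (b₀ + k * t₀) - b₀ * b₀ ≡ t₀ * (b₀ + b₀ + k * t₀) * k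
  square-shift = solve-∀
  regroup : ∀ x y A B → x - y + (A - B) ≡ x + A - (y + B)
  regroup = solve-∀

+ᵥ-identityˡ : ∀ {n} (v : Vec ℤ n) → replicate n (+ 0) +ᵥ v ≡ v
+ᵥ-identityˡ [] = refl
+ᵥ-identityˡ (x ∷ v) = cong₂ _∷_ (ℤ.+-identityˡ x) (+ᵥ-identityˡ v)

sumSq-*ᵥ : ∀ {n} k (v : Vec ℤ n) → sumSq (k *ᵥ v) ≡ k * k * sumSq v
sumSq-*ᵥ k [] = sym (ℤ.*-zeroʳ (k * k))
sumSq-*ᵥ k (x ∷ v) = trans (cong (λ s → k * x * (k * x) + s) (sumSq-*ᵥ k v)) (distrib k x (sumSq v))
  where
  distrib : ∀ k x s → k * x * (k * x) + k * k * s ≡ k * k * (x * x + s)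
  distrib = solve-∀

[x+x]²∣sumSq[x+[x+x]t] : ∀ x (t : Vec ℤ 4) → (x + x) * (x + x) ℤ.∣ sumSq (replicate 4 x +ᵥ (x + x) *ᵥ t)
[x+x]²∣sumSq[x+[x+x]t] x (t₁ ∷ t₂ ∷ t₃ ∷ t₄ ∷ []) =
  ℤ.divides (t₁ * t₁ + t₁ + t₂ * t₂ + t₂ + t₃ * t₃ + t₃ + t₄ * t₄ + t₄ + + 1) (identity x t₁ t₂ t₃ t₄)
  where
  identity : ∀ x t₁ t₂ t₃ t₄ →
    let ‖_,_,_,_‖ : ℤ → ℤ → ℤ → ℤ → ℤ
        ‖ w , y , z , u ‖ = w * w + (y * y + (z * z + (u * u + + 0)))
        k = x + x
    in ‖ x + k * t₁ , x + k * t₂ , x + k * t₃ , x + k * t₄ ‖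
       ≡ (t₁ * t₁ + t₁ + t₂ * t₂ + t₂ + t₃ * t₃ + t₃ + t₄ * t₄ + t₄ + + 1) * (k * k)
  identity = solve-∀

k*k∣sumSq[0+kt] : ∀ {n} k (t : Vec ℤ n) → k * k ℤ.∣ sumSq (replicate n (+ 0) +ᵥ k *ᵥ t)
k*k∣sumSq[0+kt] k t = ℤ.divides (sumSq t)
  (trans (cong sumSq (+ᵥ-identityˡ (k *ᵥ t))) (trans (sumSq-*ᵥ k t) (ℤ.*-comm (k * k) (sumSq t))))

i+i≡j+j⇒i≡j : ∀ {x y} → x + x ≡ y + y → x ≡ y
i+i≡j+j⇒i≡j {x} {y} e = ℤ.*-cancelˡ-≡ (+ 2) x y (trans (double x) (trans e (sym (double y))))
  where
  double : ∀ x → + 2 * x ≡ x + x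
  double = solve-∀

halves⇒replicate : ∀ {n x} {b : Vec ℤ n} → All (λ y → y + y ≡ x + x) b → b ≡ replicate n x
halves⇒replicate [] = refl
halves⇒replicate (e ∷ es) = cong₂ _∷_ (i+i≡j+j⇒i≡j e) (halves⇒replicate es)

k*k∣sumSq[halves+kt] : ∀ {k} (b t : Vec ℤ 4) → All (λ y → y + y ≡ + k) b → + k * + k ℤ.∣ sumSq (b +ᵥ + k *ᵥ t)
k*k∣sumSq[halves+kt] {k} b@(x ∷ _) t halves@(x+x≡k ∷ _) =
  subst (λ K → K * K ℤ.∣ sumSq (b +ᵥ K *ᵥ t)) x+x≡k
    (subst (λ b → (x + x) * (x + x) ℤ.∣ sumSq (b +ᵥ (x + x) *ᵥ t))
      (sym (halves⇒replicate (All.map (λ e → trans e (sym x+x≡k)) halves)))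
      ([x+x]²∣sumSq[x+[x+x]t] x t))

k*k∣k*m⇒k∣m : ∀ {k m} .{{_ : NonZero k}} → + k * + k ℤ.∣ + (k ℕ.* m) → k ∣ m
k*k∣k*m⇒k∣m {k} {m} d = *-cancelˡ-∣ k (subst (_∣ k ℕ.* m) (ℤ.∣i*j∣≡∣i∣*∣j∣ (+ k) (+ k)) (ℤ.∣⇒∣ᵤ d))

-- A representative of its residue class modulo k lying in the interval (-k/2, k/2].
data Centred (k : ℕ) : ℤ → Set where
  inside : ∀ {x} → ∣ x ∣ ℕ.+ ∣ x ∣ < k → Centred k x
  half   : ∀ {h} → h ℕ.+ h ≡ k → Centred k (+ h)

centredResidue : ∀ k .{{_ : NonZero k}} a → ∃[ r ] ∃[ q ] Centred k r × a ≡ r + + k * q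
centredResidue k a with a %ℕ k ℕ.+ a %ℕ k ℕ.≤? k
... | yes 2r≤k = + (a %ℕ k) , a /ℕ k , centred (ℕ.m≤n⇒m<n∨m≡n 2r≤k) ,
                 trans (a≡a%ℕn+[a/ℕn]*n a k) (cong (λ z → + (a %ℕ k) + z) (ℤ.*-comm (a /ℕ k) (+ k)))
  where
  centred : a %ℕ k ℕ.+ a %ℕ k < k ⊎ a %ℕ k ℕ.+ a %ℕ k ≡ k → Centred k (+ (a %ℕ k))
  centred (inj₁ 2r<k) = inside 2r<k
  centred (inj₂ 2r≡k) = half 2r≡k
... | no 2r≰k = - + s , q + + 1 , inside 2s<k , (begin
    a                          ≡⟨ a≡a%ℕn+[a/ℕn]*n a k ⟩
    + r + q * + k              ≡⟨ cong (λ K → + r + q * K) k≡s+r ⟩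
    + r + q * (+ s + + r)      ≡⟨ regroup (+ r) (+ s) q ⟩
    - + s + (+ s + + r) * (q + + 1) ≡⟨ cong (λ K → - + s + K * (q + + 1)) k≡s+r ⟨
    - + s + + k * (q + + 1)    ∎)
  where
  open ≡-Reasoning
  r = a %ℕ k
  q = a /ℕ k
  s = k ∸ r
  s+r≡k : s ℕ.+ r ≡ k
  s+r≡k = ℕ.m∸n+n≡m (ℕ.<⇒≤ (n%ℕd<d a k))
  k≡s+r : + k ≡ + s + + r
  k≡s+r = cong +_ (sym s+r≡k)
  s<r : s < r
  s<r = ℕ.+-cancelʳ-< r s r (subst (_< r ℕ.+ r) (sym s+r≡k) (ℕ.≰⇒> 2r≰k))
  2s<k : ∣ - + s ∣ ℕ.+ ∣ - + s ∣ < k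
  2s<k = subst (λ u → u ℕ.+ u < k) (sym (ℤ.∣-i∣≡∣i∣ (+ s))) (subst (s ℕ.+ s <_) s+r≡k (ℕ.+-monoʳ-< s s<r))
  regroup : ∀ r s q → r + q * (s + r) ≡ - s + (s + r) * (q + + 1)
  regroup = solve-∀

centredResidues : ∀ {n} k .{{_ : NonZero k}} (a : Vec ℤ n) →
  ∃[ b ] ∃[ t ] All (Centred k) b × a ≡ b +ᵥ + k *ᵥ t
centredResidues k [] = [] , [] , [] , refl
centredResidues k (a₀ ∷ a) with centredResidue k a₀ | centredResidues k a
... | r , q , c , refl | b , t , cs , refl = r ∷ b , q ∷ t , c ∷ cs , refl

sumSqℕ : ∀ {n} → Vec ℤ n → ℕ
sumSqℕ [] = 0
sumSqℕ (x ∷ v) = ∣ x ∣ ℕ.* ∣ x ∣ ℕ.+ sumSqℕ v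

sumSq≡sumSqℕ : ∀ {n} (v : Vec ℤ n) → sumSq v ≡ + sumSqℕ v
sumSq≡sumSqℕ [] = refl
sumSq≡sumSqℕ (x ∷ v) = cong₂ _+_ (square x) (sumSq≡sumSqℕ v)
  where
  square : ∀ x → x * x ≡ + (∣ x ∣ ℕ.* ∣ x ∣)
  square (+ n) = sym (ℤ.pos-* n n)
  square -[1+ n ] = refl

sumSqℕ≡0⇒zeros : ∀ {n} (v : Vec ℤ n) → sumSqℕ v ≡ 0 → v ≡ replicate n (+ 0)
sumSqℕ≡0⇒zeros [] _ = refl
sumSqℕ≡0⇒zeros (x ∷ v) e = cong₂ _∷_
  (ℤ.∣i∣≡0⇒i≡0 ([ id , id ]′ (ℕ.m*n≡0⇒m≡0∨n≡0 ∣ x ∣ (ℕ.m+n≡0⇒m≡0 _ e))))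
  (sumSqℕ≡0⇒zeros v (ℕ.m+n≡0⇒n≡0 _ e))

k∣sumSq[b+kt]⇒k∣sumSqℕ[b] : ∀ {n k} (b t : Vec ℤ n) → + k ℤ.∣ sumSq (b +ᵥ + k *ᵥ t) → k ∣ sumSqℕ b
k∣sumSq[b+kt]⇒k∣sumSqℕ[b] {k = k} b t k∣a =
  subst (k ∣_) (cong ∣_∣ (trans (cancel (sumSq (b +ᵥ + k *ᵥ t)) (sumSq b)) (sumSq≡sumSqℕ b)))
    (ℤ.∣⇒∣ᵤ (ℤ.∣m∣n⇒∣m-n k∣a (k∣sumSq[b+kt]-sumSq[b] (+ k) b t)))
  where
  cancel : ∀ a b → a - (a - b) ≡ b
  cancel = solve-∀

centred-≤ : ∀ {k x} → Centred k x → ∣ x ∣ ℕ.+ ∣ x ∣ ≤ k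
centred-≤ (inside 2x<k) = ℕ.<⇒≤ 2x<k
centred-≤ (half refl) = ℕ.≤-refl

centred-tight : ∀ {k x} → Centred k x → (∣ x ∣ ℕ.+ ∣ x ∣) ℕ.* (∣ x ∣ ℕ.+ ∣ x ∣) ≡ k ℕ.* k → x + x ≡ + k
centred-tight (inside 2x<k) e = ⊥-elim (ℕ.<⇒≢ (ℕ.*-mono-< 2x<k 2x<k) e)
centred-tight (half refl) _ = refl

4*[m*m+n]≡[m+m]*[m+m]+4*n : ∀ m n → 4 ℕ.* (m ℕ.* m ℕ.+ n) ≡ (m ℕ.+ m) ℕ.* (m ℕ.+ m) ℕ.+ 4 ℕ.* n
4*[m*m+n]≡[m+m]*[m+m]+4*n = ℕ.solve-∀

+-≤-tight : ∀ {a b c d} → a ≤ c → b ≤ d → a ℕ.+ b ≡ c ℕ.+ d → a ≡ c × b ≡ d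
+-≤-tight {a} {b} {c} {d} a≤c b≤d e = a≡c , ℕ.+-cancelˡ-≡ c b d (trans (cong (ℕ._+ b) (sym a≡c)) e)
  where
  a≡c : a ≡ c
  a≡c = ℕ.≤-antisym a≤c (ℕ.≮⇒≥ λ a<c → ℕ.<⇒≢ (ℕ.+-mono-<-≤ a<c b≤d) e)

sumSqℕ-centred-≤ : ∀ {n k} {b : Vec ℤ n} → All (Centred k) b → 4 ℕ.* sumSqℕ b ≤ n ℕ.* (k ℕ.* k)
sumSqℕ-centred-≤ [] = z≤n
sumSqℕ-centred-≤ {b = x ∷ b} (c ∷ cs) = ℕ.≤-trans
  (ℕ.≤-reflexive (4*[m*m+n]≡[m+m]*[m+m]+4*n ∣ x ∣ (sumSqℕ b)))
  (ℕ.+-mono-≤ (ℕ.*-mono-≤ (centred-≤ c) (centred-≤ c)) (sumSqℕ-centred-≤ cs))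

sumSqℕ-centred-tight : ∀ {n k} {b : Vec ℤ n} → All (Centred k) b →
  4 ℕ.* sumSqℕ b ≡ n ℕ.* (k ℕ.* k) → All (λ x → x + x ≡ + k) b
sumSqℕ-centred-tight [] _ = []
sumSqℕ-centred-tight {b = x ∷ b} (c ∷ cs) e
  with +-≤-tight (ℕ.*-mono-≤ (centred-≤ c) (centred-≤ c)) (sumSqℕ-centred-≤ cs)
                 (trans (sym (4*[m*m+n]≡[m+m]*[m+m]+4*n ∣ x ∣ (sumSqℕ b))) e)
... | head-tight , tail-tight = centred-tight c head-tight ∷ sumSqℕ-centred-tight cs tail-tight

fourSquares-descent : ∀ {k m} .{{_ : NonZero k}} → ¬ k ∣ m → FourSquares (k ℕ.* m) →
  ∃[ r ] 0 < r × r < k × FourSquares (r ℕ.* m)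
fourSquares-descent {k} {m} k∤m (a , sumSq-a) with centredResidues k a
... | b , t , b-centred , refl = reduce (k∣sumSq[b+kt]⇒k∣sumSqℕ[b] b t k∣sumSq-a)
  where
  k∣sumSq-a : + k ℤ.∣ sumSq (b +ᵥ + k *ᵥ t)
  k∣sumSq-a = ℤ.divides (+ m) (trans sumSq-a (trans (ℤ.pos-* k m) (ℤ.*-comm (+ k) (+ m))))
  k²∤sumSq-a : ¬ + k * + k ℤ.∣ sumSq (b +ᵥ + k *ᵥ t)
  k²∤sumSq-a k²∣ = k∤m (k*k∣k*m⇒k∣m (subst (+ k * + k ℤ.∣_) sumSq-a k²∣))
  -- r = 0 forces b = 0 and r = k forces every entry of b to be k/2; either way k² ∣ |a|².
  reduce : k ∣ sumSqℕ b → ∃[ r ] 0 < r × r < k × FourSquares (r ℕ.* m)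
  reduce (divides r |b|²≡rk) with r ℕ.≟ 0 | r ℕ.≟ k
  ... | yes refl | _ = ⊥-elim (k²∤sumSq-a
        (subst (λ b → + k * + k ℤ.∣ sumSq (b +ᵥ + k *ᵥ t)) (sym (sumSqℕ≡0⇒zeros b |b|²≡rk)) (k*k∣sumSq[0+kt] (+ k) t)))
  ... | no _ | yes refl = ⊥-elim (k²∤sumSq-a
        (k*k∣sumSq[halves+kt] b t (sumSqℕ-centred-tight b-centred (cong (4 ℕ.*_) |b|²≡rk))))
  ... | no r≢0 | no r≢k = r , ℕ.n≢0⇒n>0 r≢0 , ℕ.≤∧≢⇒< r≤k r≢k ,
        euler-descent {r = r} b t (trans (sumSq≡sumSqℕ b) (cong +_ |b|²≡rk)) sumSq-a
    where
    r≤k : r ≤ k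
    r≤k = ℕ.*-cancelʳ-≤ r k k (ℕ.*-cancelˡ-≤ 4 (subst (λ s → 4 ℕ.* s ≤ 4 ℕ.* (k ℕ.* k)) |b|²≡rk (sumSqℕ-centred-≤ b-centred)))

-- Lagrange's four-square theorem

%-≡⇒∣∸ : ∀ a b p .{{_ : NonZero p}} → a % p ≡ b % p → p ∣ b ∸ a
%-≡⇒∣∸ a b p a%p≡b%p = divides (b / p ∸ a / p) (begin
  b ∸ a                                                   ≡⟨ cong₂ _∸_ (m≡m%n+[m/n]*n b p) (m≡m%n+[m/n]*n a p) ⟩
  (b % p ℕ.+ b / p ℕ.* p) ∸ (a % p ℕ.+ a / p ℕ.* p)       ≡⟨ cong (λ z → (b % p ℕ.+ b / p ℕ.* p) ∸ (z ℕ.+ a / p ℕ.* p)) a%p≡b%p ⟩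
  (b % p ℕ.+ b / p ℕ.* p) ∸ (b % p ℕ.+ a / p ℕ.* p)       ≡⟨ ℕ.[m+n]∸[m+o]≡n∸o (b % p) _ _ ⟩
  b / p ℕ.* p ∸ a / p ℕ.* p                               ≡⟨ ℕ.*-distribʳ-∸ p (b / p) (a / p) ⟨
  (b / p ∸ a / p) ℕ.* p                                   ∎)
  where open ≡-Reasoning

m*m∸n*n≡[m∸n]*[m+n] : ∀ {m n} → n ≤ m → m ℕ.* m ∸ n ℕ.* n ≡ (m ∸ n) ℕ.* (m ℕ.+ n)
m*m∸n*n≡[m∸n]*[m+n] {m} {n} n≤m = begin
  m ℕ.* m ∸ n ℕ.* n                       ≡⟨ cong (λ m → m ℕ.* m ∸ n ℕ.* n) d+n≡m ⟨
  (d ℕ.+ n) ℕ.* (d ℕ.+ n) ∸ n ℕ.* n       ≡⟨ cong (_∸ n ℕ.* n) (expand d n) ⟩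
  d ℕ.* (d ℕ.+ n ℕ.+ n) ℕ.+ n ℕ.* n ∸ n ℕ.* n ≡⟨ ℕ.m+n∸n≡m _ (n ℕ.* n) ⟩
  d ℕ.* (d ℕ.+ n ℕ.+ n)                   ≡⟨ cong (λ m → d ℕ.* (m ℕ.+ n)) d+n≡m ⟩
  d ℕ.* (m ℕ.+ n)                         ∎
  where
  open ≡-Reasoning
  d : ℕ
  d = m ∸ n
  d+n≡m : d ℕ.+ n ≡ m
  d+n≡m = ℕ.m∸n+n≡m n≤m
  expand : ∀ d n → (d ℕ.+ n) ℕ.* (d ℕ.+ n) ≡ d ℕ.* (d ℕ.+ n ℕ.+ n) ℕ.+ n ℕ.* n
  expand = ℕ.solve-∀

squares-mod-distinct : ∀ {p x y} .{{_ : NonZero p}} → Prime p → x < y → x ℕ.+ y < p →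
  x ℕ.* x % p ≢ y ℕ.* y % p
squares-mod-distinct {p} {x} {y} p-prime x<y x+y<p x²≡y²
  with euclidsLemma (y ∸ x) (y ℕ.+ x) p-prime
         (subst (p ∣_) (m*m∸n*n≡[m∸n]*[m+n] (ℕ.<⇒≤ x<y)) (%-≡⇒∣∸ (x ℕ.* x) (y ℕ.* y) p x²≡y²))
... | inj₁ p∣y∸x = ℕ.<⇒≱ (ℕ.≤-<-trans (ℕ.m∸n≤m y x) (ℕ.≤-<-trans (ℕ.m≤n+m y x) x+y<p))
                        (∣⇒≤ ⦃ ℕ.>-nonZero (ℕ.m<n⇒0<n∸m x<y) ⦄ p∣y∸x)
... | inj₂ p∣y+x = ℕ.<⇒≱ (subst (_< p) (ℕ.+-comm x y) x+y<p)
                        (∣⇒≤ ⦃ ℕ.>-nonZero (ℕ.<-≤-trans (ℕ.≤-<-trans z≤n x<y) (ℕ.m≤m+n y x)) ⦄ p∣y+x)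

module OddPrime (h : ℕ) where

  p : ℕ
  p = suc (h ℕ.+ h)

  sqMod : ℕ → ℕ
  sqMod x = x ℕ.* x % p

  -- Indices i ≤ h give i² mod p, indices h < i ≤ 2h + 1 give −1 − y² mod p with y = i − h − 1.
  residue : ℕ → ℕ
  residue i with i ℕ.≤? h
  ... | yes _ = sqMod i
  ... | no  _ = h ℕ.+ h ∸ sqMod (i ∸ suc h)

  sqMod≤2h : ∀ x → sqMod x ≤ h ℕ.+ h
  sqMod≤2h x = ℕ.s≤s⁻¹ (m%n<n (x ℕ.* x) p)

  residue<p : ∀ i → residue i < p
  residue<p i with i ℕ.≤? h
  ... | yes _ = m%n<n (i ℕ.* i) p
  ... | no  _ = s≤s (ℕ.m∸n≤m (h ℕ.+ h) (sqMod (i ∸ suc h)))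

  shifted≤h : ∀ {j} → j ≤ p → j ∸ suc h ≤ h
  shifted≤h {j} j≤p = subst (j ∸ suc h ≤_) (ℕ.m+n∸m≡n (suc h) h) (ℕ.∸-monoˡ-≤ (suc h) j≤p)

  residue-collision : ∀ {i j} → Prime p → i < j → j ≤ p → residue i ≡ residue j →
    ∃[ x ] ∃[ y ] x ≤ h × y ≤ h × sqMod x ℕ.+ sqMod y ≡ h ℕ.+ h
  residue-collision {i} {j} p-prime i<j j≤p same with i ℕ.≤? h | j ℕ.≤? h
  ... | yes i≤h | yes j≤h = ⊥-elim (squares-mod-distinct p-prime i<j (s≤s (ℕ.+-mono-≤ i≤h j≤h)) same)
  ... | yes i≤h | no  _   = i , j ∸ suc h , i≤h , shifted≤h j≤p ,
                            trans (cong (ℕ._+ sqMod (j ∸ suc h)) same) (ℕ.m∸n+n≡m (sqMod≤2h (j ∸ suc h)))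
  ... | no  i≰h | yes j≤h = ⊥-elim (i≰h (ℕ.≤-trans (ℕ.<⇒≤ i<j) j≤h))
  ... | no  i≰h | no  _   = ⊥-elim (squares-mod-distinct p-prime
          (ℕ.∸-monoˡ-< i<j (ℕ.≰⇒> i≰h))
          (s≤s (ℕ.+-mono-≤ (ℕ.≤-trans (ℕ.∸-monoˡ-≤ (suc h) (ℕ.<⇒≤ i<j)) (shifted≤h j≤p)) (shifted≤h j≤p)))
          (ℕ.∸-cancelˡ-≡ (sqMod≤2h (i ∸ suc h)) (sqMod≤2h (j ∸ suc h)) same))

  small-multiple : Prime p → ∃[ k ] 0 < k × k < p × FourSquares (k ℕ.* p)
  small-multiple p-prime
    with Fin.pigeonhole (ℕ.n<1+n p) (λ i → fromℕ< (residue<p (toℕ i)))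
  ... | i , j , i<j , same
    with residue-collision p-prime i<j (ℕ.s≤s⁻¹ (Fin.toℕ<n j))
           (trans (sym (Fin.toℕ-fromℕ< _)) (trans (cong toℕ same) (Fin.toℕ-fromℕ< _)))
  ... | x , y , x≤h , y≤h , sum≡2h = suc (A ℕ.+ B) , s≤s z≤n , k<p , (+ x ∷ + y ∷ + 1 ∷ + 0 ∷ []) ,
        trans (cong₂ (λ u v → u + (v + + 1)) (sym (ℤ.pos-* x x)) (sym (ℤ.pos-* y y))) (cong +_ x²+y²+1≡kp)
    where
    A B : ℕ
    A = x ℕ.* x / p
    B = y ℕ.* y / p
    x²+y²+1≡kp : x ℕ.* x ℕ.+ (y ℕ.* y ℕ.+ 1) ≡ suc (A ℕ.+ B) ℕ.* p
    x²+y²+1≡kp = begin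
      x ℕ.* x ℕ.+ (y ℕ.* y ℕ.+ 1)                           ≡⟨ cong₂ (λ u v → u ℕ.+ (v ℕ.+ 1))
                                                                  (m≡m%n+[m/n]*n (x ℕ.* x) p) (m≡m%n+[m/n]*n (y ℕ.* y) p) ⟩
      sqMod x ℕ.+ A ℕ.* p ℕ.+ (sqMod y ℕ.+ B ℕ.* p ℕ.+ 1)   ≡⟨ regroup (sqMod x) (sqMod y) A B p ⟩
      1 ℕ.+ (sqMod x ℕ.+ sqMod y) ℕ.+ (A ℕ.+ B) ℕ.* p       ≡⟨ cong (λ s → 1 ℕ.+ s ℕ.+ (A ℕ.+ B) ℕ.* p) sum≡2h ⟩
      suc (A ℕ.+ B) ℕ.* p                                   ∎
      where
      open ≡-Reasoning
      regroup : ∀ a b A B p → a ℕ.+ A ℕ.* p ℕ.+ (b ℕ.+ B ℕ.* p ℕ.+ 1) ≡ 1 ℕ.+ (a ℕ.+ b) ℕ.+ (A ℕ.+ B) ℕ.* p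
      regroup = ℕ.solve-∀
    sq≤ : ∀ {z} → z ≤ h → z ℕ.* z ≤ h ℕ.* p
    sq≤ z≤h = ℕ.*-mono-≤ z≤h (ℕ.≤-trans z≤h (ℕ.≤-trans (ℕ.m≤m+n h h) (ℕ.n≤1+n _)))
    x²+y²+1<p² : x ℕ.* x ℕ.+ (y ℕ.* y ℕ.+ 1) < p ℕ.* p
    x²+y²+1<p² = begin-strict
      x ℕ.* x ℕ.+ (y ℕ.* y ℕ.+ 1)  ≤⟨ ℕ.+-mono-≤ (sq≤ x≤h) (ℕ.+-monoˡ-≤ 1 (sq≤ y≤h)) ⟩
      h ℕ.* p ℕ.+ (h ℕ.* p ℕ.+ 1)  <⟨ ℕ.+-monoʳ-< (h ℕ.* p) (ℕ.+-monoʳ-< (h ℕ.* p) (ℕ.nonTrivial⇒n>1 p ⦃ prime⇒nonTrivial p-prime ⦄)) ⟩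
      h ℕ.* p ℕ.+ (h ℕ.* p ℕ.+ p)  ≡⟨ square h ⟩
      p ℕ.* p                      ∎
      where
      open ℕ.≤-Reasoning
      square : ∀ h → h ℕ.* (1 ℕ.+ (h ℕ.+ h)) ℕ.+ (h ℕ.* (1 ℕ.+ (h ℕ.+ h)) ℕ.+ (1 ℕ.+ (h ℕ.+ h)))
                     ≡ (1 ℕ.+ (h ℕ.+ h)) ℕ.* (1 ℕ.+ (h ℕ.+ h))
      square = ℕ.solve-∀
    k<p : suc (A ℕ.+ B) < p
    k<p = ℕ.*-cancelʳ-< p (suc (A ℕ.+ B)) p (subst (_< p ℕ.* p) x²+y²+1≡kp x²+y²+1<p²)

fourSquares-from-multiple : ∀ {p} → Prime p → ∃[ k ] 0 < k × k < p × FourSquares (k ℕ.* p) → FourSquares p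
fourSquares-from-multiple {p} p-prime (k , 0<k , k<p , s) =
  <-rec (λ k → 0 < k → k < p → FourSquares (k ℕ.* p) → FourSquares p) descend k 0<k k<p s
  where
  descend : ∀ k → (∀ {j} → j < k → 0 < j → j < p → FourSquares (j ℕ.* p) → FourSquares p) →
            0 < k → k < p → FourSquares (k ℕ.* p) → FourSquares p
  descend zero _ () _ _
  descend (suc zero) _ _ _ s = subst FourSquares (ℕ.*-identityˡ p) s
  descend k@(suc (suc _)) smaller _ k<p s
    with fourSquares-descent (λ k∣p → Prime.notComposite p-prime (composite k<p k∣p)) s
  ... | r , 0<r , r<k , s′ = smaller r<k 0<r (ℕ.<-trans r<k k<p) s′

even-or-odd : ∀ n → ∃[ h ] (n ≡ h ℕ.+ h ⊎ n ≡ suc (h ℕ.+ h))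
even-or-odd zero = 0 , inj₁ refl
even-or-odd (suc n) with even-or-odd n
... | h , inj₁ refl = h , inj₂ refl
... | h , inj₂ refl = suc h , inj₁ (cong suc (sym (ℕ.+-suc h h)))

even-prime : ∀ {h} → Prime (h ℕ.+ h) → h ≡ 1
even-prime {zero} p-prime = ⊥-elim (¬prime[0] p-prime)
even-prime {suc zero} _ = refl
even-prime {h@(suc (suc _))} p-prime = ⊥-elim (Prime.notComposite p-prime
  (composite (ℕ.+-mono-<-≤ {1} {h} {1} {h} (s≤s (s≤s z≤n)) (s≤s z≤n)) (divides h (double h))))
  where
  double : ∀ h → h ℕ.+ h ≡ h ℕ.* 2
  double = ℕ.solve-∀

fourSquares-prime : ∀ {p} → Prime p → FourSquares p
fourSquares-prime {p} p-prime with even-or-odd p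
... | h , inj₁ refl with even-prime {h} p-prime
...   | refl = + 1 ∷ + 1 ∷ + 0 ∷ + 0 ∷ [] , refl
fourSquares-prime {p} p-prime | h , inj₂ refl = fourSquares-from-multiple p-prime (OddPrime.small-multiple h p-prime)

fourSquares-product : ∀ {ps} → ListAll.All Prime ps → FourSquares (product ps)
fourSquares-product ListAll.[] = + 1 ∷ + 0 ∷ + 0 ∷ + 0 ∷ [] , refl
fourSquares-product (p-prime ListAll.∷ ps-prime) = fourSquares-* (fourSquares-prime p-prime) (fourSquares-product ps-prime)

fourSquares : ∀ m → FourSquares m
fourSquares zero = replicate 4 (+ 0) , refl
fourSquares m@(suc _) = subst FourSquares (sym isFactorisation) (fourSquares-product factorsPrime)
  where open PrimeFactorisation (factorise m)

-- Solutions of the extended equation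

finiteWithMoreThan : ∀ {A : Set} {P : A → Set} {d} → DecidableEquality A → Decidable P → FiniteSet P →
  (K : List A) → Unique K → (∀ {a} → a ∈ K → P a) → d < length K → FiniteWithMoreThan P d
finiteWithMoreThan {A} {P} _≟_ P? (C , C-complete) K K-unique K⊆P d<|K| =
  K ++ extra , Unique.++⁺ K-unique (Unique.filter⁺ new? (deduplicate-! _≟_ C)) disjoint ,
  (λ a → mk⇔ (sound a) (complete a)) ,
  ℕ.<-≤-trans d<|K| (subst (length K ≤_) (sym (List.length-++ K)) (ℕ.m≤m+n (length K) (length extra)))
  where
  new? : Decidable (λ a → P a × a ∉ K)
  new? a = P? a ×-dec ¬? (_∈?_ _≟_ a K)
  extra : List A
  extra = filter new? (deduplicate _≟_ C)
  disjoint : ∀ {a} → ¬ (a ∈ K × a ∈ extra)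
  disjoint (a∈K , a∈extra) = proj₂ (proj₂ (∈-filter⁻ new? {xs = deduplicate _≟_ C} a∈extra)) a∈K
  sound : ∀ a → a ∈ K ++ extra → P a
  sound a a∈ with ∈-++⁻ K a∈
  ... | inj₁ a∈K = K⊆P a∈K
  ... | inj₂ a∈extra = proj₁ (proj₂ (∈-filter⁻ new? {xs = deduplicate _≟_ C} a∈extra))
  complete : ∀ a → P a → a ∈ K ++ extra
  complete a Pa with _∈?_ _≟_ a K
  ... | yes a∈K = ∈-++⁺ˡ a∈K
  ... | no  a∉K = ∈-++⁺ʳ K (∈-filter⁺ new? (∈-deduplicate⁺ _≟_ (C-complete a Pa)) (Pa , a∉K))

Tuple : ℕ → Set
Tuple n = Vec ℤ n × Vec ℤ 4 × Vec ℤ 4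

a-b-c≡0⇔a≡b+c : ∀ a b c → a - b - c ≡ + 0 ⇔ a ≡ b + c
a-b-c≡0⇔a≡b+c a b c = mk⇔
  (λ e → ℤ.i-j≡0⇒i≡j a (b + c) (trans (regroup a b c) e))
  (λ e → trans (cong (λ a → a - b - c) e) (cancel b c))
  where
  regroup : ∀ a b c → a - (b + c) ≡ a - b - c
  regroup = solve-∀
  cancel : ∀ b c → b + c - b - c ≡ + 0
  cancel = solve-∀

sumSq≡0⇒zeros : ∀ {n} (v : Vec ℤ n) → sumSq v ≡ + 0 → v ≡ replicate n (+ 0)
sumSq≡0⇒zeros v e = sumSqℕ≡0⇒zeros v (ℤ.+-injective (trans (sym (sumSq≡sumSqℕ v)) e))

extSol⇔ : ∀ {n} (D : Poly n) x u v →
  ExtSol D (x , u , v) ⇔ (eval D x ≡ + 0 × + (n ℕ.* n) + sumSq x ≡ sumSq u + sumSq v)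
extSol⇔ {n} D x u v = mk⇔ to from
  where
  E : ℤ
  E = + (n ℕ.* n) + sumSq x - sumSq u - sumSq v
  to : ExtSol D (x , u , v) → eval D x ≡ + 0 × + (n ℕ.* n) + sumSq x ≡ sumSq u + sumSq v
  to sol with sumSq≡0⇒zeros (eval D x ∷ E ∷ [])
                (trans (cong (λ s → eval D x * eval D x + s) (ℤ.+-identityʳ (E * E))) sol)
  ... | Dx∷E≡0 = Vec.∷-injectiveˡ Dx∷E≡0 ,
                 Equivalence.to (a-b-c≡0⇔a≡b+c _ _ _) (Vec.∷-injectiveˡ (Vec.∷-injectiveʳ Dx∷E≡0))
  from : eval D x ≡ + 0 × + (n ℕ.* n) + sumSq x ≡ sumSq u + sumSq v → ExtSol D (x , u , v)
  from (Dx≡0 , balanced) = subst₂ (λ d e → d * d + e * e ≡ + 0) (sym Dx≡0)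
                             (sym (Equivalence.from (a-b-c≡0⇔a≡b+c _ _ _) balanced)) refl

intsUpTo : ℕ → List ℤ
intsUpTo B = List.map +_ (upTo (suc B)) ++ List.map -[1+_] (upTo B)

∈-intsUpTo : ∀ {B a} → ∣ a ∣ ≤ B → a ∈ intsUpTo B
∈-intsUpTo {B} {+ m} m≤B = ∈-++⁺ˡ (∈-map⁺ +_ (∈-upTo⁺ (s≤s m≤B)))
∈-intsUpTo {B} { -[1+ m ]} 1+m≤B = ∈-++⁺ʳ (List.map +_ (upTo (suc B))) (∈-map⁺ -[1+_] (∈-upTo⁺ 1+m≤B))

vecsOver : ∀ {A : Set} k → List A → List (Vec A k)
vecsOver zero L = List.[ [] ]
vecsOver (suc k) L = cartesianProductWith _∷_ L (vecsOver k L)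

∈-vecsOver : ∀ {A : Set} {k} {L : List A} {w : Vec A k} → All (_∈ L) w → w ∈ vecsOver k L
∈-vecsOver [] = here refl
∈-vecsOver (a∈L ∷ w∈L) = ∈-cartesianProductWith⁺ _∷_ a∈L (∈-vecsOver w∈L)

m≤m*m : ∀ m → m ≤ m ℕ.* m
m≤m*m zero = z≤n
m≤m*m (suc m) = ℕ.m≤m*n (suc m) (suc m)

sumSqℕ≤⇒∣∣≤ : ∀ {n B} (w : Vec ℤ n) → sumSqℕ w ≤ B → All (λ a → ∣ a ∣ ≤ B) w
sumSqℕ≤⇒∣∣≤ [] _ = []
sumSqℕ≤⇒∣∣≤ (a ∷ w) le =
  ℕ.≤-trans (m≤m*m ∣ a ∣) (ℕ.≤-trans (ℕ.m≤m+n _ (sumSqℕ w)) le) ∷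
  sumSqℕ≤⇒∣∣≤ w (ℕ.≤-trans (ℕ.m≤n+m (sumSqℕ w) _) le)

target : ∀ {n} → Vec ℤ n → ℕ
target {n} x = n ℕ.* n ℕ.+ sumSqℕ x

candidates : ∀ {n} → Vec ℤ n → List (Tuple n)
candidates x = List.map (x ,_) (cartesianProduct box box)
  where
  box : List (Vec ℤ 4)
  box = vecsOver 4 (intsUpTo (target x))

extSol-finite : ∀ {n} (D : Poly n) → FiniteSet (λ x → eval D x ≡ + 0) → FiniteSet (ExtSol D)
extSol-finite {n} D (Lx , Lx-complete) = concatMap candidates Lx , complete
  where
  complete : ∀ t → ExtSol D t → t ∈ concatMap candidates Lx
  complete (x , u , v) sol with Equivalence.to (extSol⇔ D x u v) sol
  ... | Dx≡0 , balanced = ∈-concatMap⁺ candidates (Any.map (λ { refl → ∈-candidates }) (Lx-complete x Dx≡0))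
    where
    balancedℕ : target x ≡ sumSqℕ u ℕ.+ sumSqℕ v
    balancedℕ = ℤ.+-injective (trans (cong (λ s → + (n ℕ.* n) + s) (sym (sumSq≡sumSqℕ x)))
                                (trans balanced (cong₂ _+_ (sumSq≡sumSqℕ u) (sumSq≡sumSqℕ v))))
    ∈-box : ∀ w → sumSqℕ w ≤ target x → w ∈ vecsOver 4 (intsUpTo (target x))
    ∈-box w le = ∈-vecsOver (All.map ∈-intsUpTo (sumSqℕ≤⇒∣∣≤ w le))
    ∈-candidates : (x , u , v) ∈ candidates x
    ∈-candidates = ∈-map⁺ (x ,_) (∈-cartesianProduct⁺
      (∈-box u (subst (sumSqℕ u ≤_) (sym balancedℕ) (ℕ.m≤m+n _ _)))
      (∈-box v (subst (sumSqℕ v ≤_) (sym balancedℕ) (ℕ.m≤n+m _ _))))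

⊔*⊔≤ : ∀ m n → (m ⊔ n) ℕ.* (m ⊔ n) ≤ m ℕ.* m ℕ.+ n ℕ.* n
⊔*⊔≤ m n with ℕ.≤-total m n
... | inj₁ m≤n rewrite ℕ.m≤n⇒m⊔n≡n m≤n = ℕ.m≤n+m _ _
... | inj₂ n≤m rewrite ℕ.m≥n⇒m⊔n≡m n≤m = ℕ.m≤m+n _ _

height*height≤target : ∀ {n} (x : Vec ℤ n) → height x ℕ.* height x ≤ target x
height*height≤target {n} = go
  where
  swap : ∀ a b c → a ℕ.+ (b ℕ.+ c) ≡ b ℕ.+ (a ℕ.+ c)
  swap = ℕ.solve-∀
  go : ∀ {k} (w : Vec ℤ k) → let h = Data.Vec.foldr (λ _ → ℕ) (λ a m → ∣ a ∣ ⊔ m) n w in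
       h ℕ.* h ≤ n ℕ.* n ℕ.+ sumSqℕ w
  go [] = ℕ.m≤m+n _ 0
  go (a ∷ w) = ℕ.≤-trans (⊔*⊔≤ ∣ a ∣ _) (ℕ.≤-trans (ℕ.+-monoʳ-≤ (∣ a ∣ ℕ.* ∣ a ∣) (go w))
                 (ℕ.≤-reflexive (swap (∣ a ∣ ℕ.* ∣ a ∣) (n ℕ.* n) (sumSqℕ w))))

liftSolution : ∀ {n} → Vec ℤ n → ℕ → Tuple n
liftSolution x k = x , proj₁ (fourSquares (target x ∸ k ℕ.* k)) , (+ k ∷ + 0 ∷ + 0 ∷ + 0 ∷ [])

liftSolution-injective : ∀ {n} {x : Vec ℤ n} {k l} → liftSolution x k ≡ liftSolution x l → k ≡ l
liftSolution-injective eq = ℤ.+-injective (cong (λ t → Data.Vec.head (proj₂ (proj₂ t))) eq)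

liftSolution-extSol : ∀ {n} (D : Poly n) {x} k → eval D x ≡ + 0 → k ℕ.* k ≤ target x → ExtSol D (liftSolution x k)
liftSolution-extSol {n} D {x} k Dx≡0 k*k≤target =
  Equivalence.from (extSol⇔ D x (proj₁ (fourSquares rest)) (+ k ∷ + 0 ∷ + 0 ∷ + 0 ∷ [])) (Dx≡0 , (begin
    + (n ℕ.* n) + sumSq x                  ≡⟨ cong (λ s → + (n ℕ.* n) + s) (sumSq≡sumSqℕ x) ⟩
    + target x                             ≡⟨ cong +_ (ℕ.m∸n+n≡m k*k≤target) ⟨
    + rest + + (k ℕ.* k)                   ≡⟨ cong₂ _+_ (proj₂ (fourSquares rest)) sumSq-k ⟨
    sumSq (proj₁ (fourSquares rest)) + sumSq (+ k ∷ + 0 ∷ + 0 ∷ + 0 ∷ []) ∎))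
  where
  open ≡-Reasoning
  rest : ℕ
  rest = target x ∸ k ℕ.* k
  sumSq-k : sumSq (+ k ∷ + 0 ∷ + 0 ∷ + 0 ∷ []) ≡ + (k ℕ.* k)
  sumSq-k = trans (ℤ.+-identityʳ (+ k * + k)) (sym (ℤ.pos-* k k))

_≟-tuple_ : ∀ {n} → DecidableEquality (Tuple n)
_≟-tuple_ = Product.≡-dec (Vec.≡-dec ℤ._≟_) (Product.≡-dec (Vec.≡-dec ℤ._≟_) (Vec.≡-dec ℤ._≟_))

extSol? : ∀ {n} (D : Poly n) → Decidable (ExtSol D)
extSol? D (x , u , v) = _ ℤ.≟ + 0

lemma2 : (n : ℕ) (D : Poly n) →
    (Σ (Vec ℤ n) λ x → eval D x ≡ + 0) →
    FiniteSet (λ x → eval D x ≡ + 0) →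
    (d : ℕ) → IsMaxSolHeight D d →
    FiniteWithMoreThan (ExtSol D) d
lemma2 n D _ D-finite d ((x₀ , Dx₀≡0 , height≡d) , _) =
  finiteWithMoreThan _≟-tuple_ (extSol? D) (extSol-finite D D-finite) lifts
    (Unique.map⁺ liftSolution-injective (Unique.upTo⁺ (suc d))) lifts-solve
    (subst (d <_) (sym (trans (List.length-map (liftSolution x₀) (upTo (suc d))) (List.length-upTo (suc d)))) (ℕ.n<1+n d))
  where
  lifts : List (Tuple n)
  lifts = List.map (liftSolution x₀) (upTo (suc d))
  lifts-solve : ∀ {t} → t ∈ lifts → ExtSol D t
  lifts-solve t∈lifts with ∈-map⁻ (liftSolution x₀) t∈lifts
  ... | k , k∈ , refl = liftSolution-extSol D k Dx₀≡0 (ℕ.≤-trans (ℕ.*-mono-≤ k≤d k≤d)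
          (subst (λ h → h ℕ.* h ≤ target x₀) height≡d (height*height≤target x₀)))
    where
    k≤d : k ≤ d
    k≤d = ℕ.s≤s⁻¹ (∈-upTo⁻ k∈)
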